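{- Let $k\geq 3$ and $1\leq r\leq k-1$ be integers and let $Q_{k,r}$, $U$, $U_0$, $V_i$, $w_i$, $W_i$ be as defined in the context. Let $X$ be any dominating set of $Q_{k,r}$. Then (a) $X$ contains at least one vertex of $U_0\cup\{w_1,\dots,w_r\}$; (b) if $U\not\subseteq X$, then $X\cap W_i\neq\varnothing$ for each $i\in\{1,\dots,r\}$, and for each $i\in\{1,\dots,r\}$, if $U\not\subseteq X$ and $w_i\notin X$, then $X\cap V_i\neq\varnothing$. If moreover $X$ is a minimal dominating set, then (c) $|X\cap W_i|\leq 1$ for each $i\in\{1,\dots,r\}$; (d) if $u_0\in X$ then $X\cap U_0=\{u_0\}$; (e) if $X\cap W_i=\varnothing$ for some $i$, then $X=U$; (f) if $w_i\in X$ for some $i$, then $X\cap U_0=\varnothing$.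
   Context: For integers $k\geq3$, $1\leq r\leq k-1$, the graph $G_{k,r}$ has vertex set $U\cup\{u_0\}\cup V_1\cup\dots\cup V_r$, where $U=\{u_1,\dots,u_k\}$ and $V_i=\{v_{i,1},\dots,v_{i,k}\}$ (all distinct); its edges: $U$ is a clique, each $V_i$ is a clique, $u_j$ is adjacent to $v_{i,j}$ for all $i,j$, and $u_0$ is adjacent to every vertex of $U$; no other edges. Let $U_0=U\cup\{u_0\}$. The graph $Q_{k,r}$ is obtained from $G_{k,r}$ by adding $r$ new vertices $w_1,\dots,w_r$, where $w_i$ is joined to every vertex of $U_0\cup V_i$ (and to nothing else). Let $W_i=V_i\cup\{w_i\}$. A dominating set is minimal if no proper subset is dominating. -}

module Defs where

open import Data.Nat using (ℕ)
open import Data.Fin using (Fin)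
open import Data.Bool using (Bool; true; false)
open import Data.Empty using (⊥)
open import Data.Unit using (⊤)
open import Data.Product using (_×_; ∃; ∃-syntax)
open import Data.Sum using (_⊎_)
open import Relation.Nullary using (¬_)
open import Relation.Binary.PropositionalEquality using (_≡_)

-- Vertices of Q_{k,r}:
--   u j   = u_{j+1}     (j : Fin k)        -- the clique U
--   u0    = u_0
--   v i j = v_{i+1,j+1} (i : Fin r, j : Fin k)
--   w i   = w_{i+1}     (i : Fin r)
data Vertex (k r : ℕ) : Set where
  u  : Fin k → Vertex k r
  u0 : Vertex k r
  v  : Fin r → Fin k → Vertex k r
  w  : Fin r → Vertex k r

Adj : ∀ {k r} → Vertex k r → Vertex k r → Set
Adj (u j)   (u j')    = ¬ (j ≡ j')
Adj (u j)   u0        = ⊤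
Adj (u j)   (v i j')  = j ≡ j'
Adj (u j)   (w i)     = ⊤
Adj u0      (u j)     = ⊤
Adj u0      u0        = ⊥
Adj u0      (v i j)   = ⊥
Adj u0      (w i)     = ⊤
Adj (v i j) (u j')    = j ≡ j'
Adj (v i j) u0        = ⊥
Adj (v i j) (v i' j') = (i ≡ i') × ¬ (j ≡ j')
Adj (v i j) (w i')    = i ≡ i'
Adj (w i)   (u j)     = ⊤
Adj (w i)   u0        = ⊤
Adj (w i)   (v i' j)  = i ≡ i'
Adj (w i)   (w i')    = ⊥

VSet : ℕ → ℕ → Set
VSet k r = Vertex k r → Bool

_∈_ : ∀ {k r} → Vertex k r → VSet k r → Set
x ∈ X = X x ≡ true

_∉_ : ∀ {k r} → Vertex k r → VSet k r → Set
x ∉ X = X x ≡ false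

_⊆_ : ∀ {k r} → VSet k r → VSet k r → Set
Y ⊆ X = ∀ x → x ∈ Y → x ∈ X

Dominating : ∀ {k r} → VSet k r → Set
Dominating {k} {r} X = ∀ (x : Vertex k r) → x ∈ X ⊎ (∃[ y ] (y ∈ X × Adj y x))

MinimalDominating : ∀ {k r} → VSet k r → Set
MinimalDominating {k} {r} X =
  Dominating X ×
  (∀ (Y : VSet k r) → Y ⊆ X → (∃[ x ] (x ∈ X × x ∉ Y)) → ¬ Dominating Y)

InU : ∀ {k r} → Vertex k r → Set
InU x = ∃[ j ] (x ≡ u j)

InU0 : ∀ {k r} → Vertex k r → Set
InU0 x = (x ≡ u0) ⊎ InU x

InV : ∀ {k r} → Fin r → Vertex k r → Set
InV i x = ∃[ j ] (x ≡ v i j)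

InW : ∀ {k r} → Fin r → Vertex k r → Set
InW i x = InV i x ⊎ (x ≡ w i)

InU0orW : ∀ {k r} → Vertex k r → Set
InU0orW x = InU0 x ⊎ (∃[ i ] (x ≡ w i))

module Submission where

-- Every vertex of U₀ ∪ {w₁,…,w_r} sees all of U, and W_i ∪ {u_j} is the closed
-- neighbourhood of v_{i,j}, so dominating u₀ forces (a) and dominating v_{i,m}
-- with u_m ∉ X forces (b).  For (c)–(f) one exhibits, for a vertex y of a minimal
-- dominating set X, another vertex of X covering every vertex that y covers, so
-- that X − y would still dominate: two vertices of the clique W_i cover each other's
-- W_i-neighbours, u_j covers the closed neighbourhood of u₀, U covers everything,
-- and w_i covers U₀.

open import Defs
open import Data.Nat using (ℕ; _≤_; _<_; s≤s)
open import Data.Fin using (Fin; zero) renaming (_≟_ to _≟ᶠ_)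
open import Data.Fin.Properties using (all?; ¬∀⟶∃¬)
open import Data.Bool using (true; false) renaming (_≟_ to _≟ᵇ_)
open import Data.Bool.Properties using (not-¬; ¬-not)
open import Data.Empty using (⊥; ⊥-elim)
open import Data.Unit using (tt)
open import Data.Product using (_×_; ∃; ∃-syntax; _,_; proj₁; proj₂)
open import Data.Sum using (_⊎_; inj₁; inj₂)
open import Function.Base using (_∘_)
open import Function.Bundles using (_⇔_; mk⇔)
open import Relation.Nullary using (¬_; Dec; yes; no)
open import Relation.Nullary.Decidable using (map′; _×-dec_)
open import Relation.Binary.PropositionalEquality using (_≡_; refl; sym; cong)

private
  variable
    k r : ℕ
    i : Fin r
    j m : Fin k
    t x y z : Vertex k r

_≟_ : (x y : Vertex k r) → Dec (x ≡ y)
u j   ≟ u j'    = map′ (cong u) (λ { refl → refl }) (j ≟ᶠ j')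
u0    ≟ u0      = yes refl
v i j ≟ v i' j' = map′ (λ { (refl , refl) → refl }) (λ { refl → refl , refl }) (i ≟ᶠ i' ×-dec j ≟ᶠ j')
w i   ≟ w i'    = map′ (cong w) (λ { refl → refl }) (i ≟ᶠ i')
u _   ≟ u0      = no λ ()
u _   ≟ v _ _   = no λ ()
u _   ≟ w _     = no λ ()
u0    ≟ u _     = no λ ()
u0    ≟ v _ _   = no λ ()
u0    ≟ w _     = no λ ()
v _ _ ≟ u _     = no λ ()
v _ _ ≟ u0      = no λ ()
v _ _ ≟ w _     = no λ ()
w _   ≟ u _     = no λ ()
w _   ≟ u0      = no λ ()
w _   ≟ v _ _   = no λ ()

_∈?_ : (x : Vertex k r) (X : VSet k r) → Dec (x ∈ X)
x ∈? X = X x ≟ᵇ true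

InU? : (x : Vertex k r) → Dec (InU x)
InU? (u j)   = yes (j , refl)
InU? u0      = no λ { (_ , ()) }
InU? (v _ _) = no λ { (_ , ()) }
InU? (w _)   = no λ { (_ , ()) }

_─_ : VSet k r → Vertex k r → VSet k r
(X ─ y) x with x ≟ y
... | yes _ = false
... | no _  = X x

Covers : Vertex k r → Vertex k r → Set
Covers t x = t ≡ x ⊎ Adj t x

Dominates : VSet k r → Vertex k r → Set
Dominates X x = x ∈ X ⊎ ∃[ t ] (t ∈ X × Adj t x)

Redundant : VSet k r → Vertex k r → Set
Redundant X y = ∀ x → Covers y x → Dominates (X ─ y) x

covers-u0 : Covers t u0 → InU0orW t
covers-u0 (inj₁ refl)                = inj₁ (inj₁ refl)
covers-u0 {t = u j} (inj₂ _)         = inj₁ (inj₂ (j , refl))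
covers-u0 {t = w i} (inj₂ _)         = inj₂ (i , refl)
covers-u0 {t = u0} (inj₂ ())
covers-u0 {t = v _ _} (inj₂ ())

u0-covers : Covers u0 x → InU0orW x
u0-covers (inj₁ refl)                = inj₁ (inj₁ refl)
u0-covers {x = u j} (inj₂ _)         = inj₁ (inj₂ (j , refl))
u0-covers {x = w i} (inj₂ _)         = inj₂ (i , refl)
u0-covers {x = u0} (inj₂ ())
u0-covers {x = v _ _} (inj₂ ())

covers-v : Covers t (v i j) → t ≡ u j ⊎ InW i t
covers-v (inj₁ refl)                     = inj₂ (inj₁ (_ , refl))
covers-v {t = u _} (inj₂ refl)           = inj₁ refl
covers-v {t = v _ j'} (inj₂ (refl , _))  = inj₂ (inj₁ (j' , refl))
covers-v {t = w _} (inj₂ refl)           = inj₂ (inj₂ refl)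
covers-v {t = u0} (inj₂ ())

v-covers : Covers (v i j) x → InW i x ⊎ x ≡ u j
v-covers (inj₁ refl)                    = inj₁ (inj₁ (_ , refl))
v-covers {x = u _} (inj₂ refl)          = inj₂ refl
v-covers {x = v _ m} (inj₂ (refl , _))  = inj₁ (inj₁ (m , refl))
v-covers {x = w _} (inj₂ refl)          = inj₁ (inj₂ refl)
v-covers {x = u0} (inj₂ ())

u-covers : Covers (u j) x → InU0 x ⊎ ∃[ i ] InW i x
u-covers (inj₁ refl)             = inj₁ (inj₂ (_ , refl))
u-covers {x = u m} (inj₂ _)      = inj₁ (inj₂ (m , refl))
u-covers {x = u0} (inj₂ _)       = inj₁ (inj₁ refl)
u-covers {x = v i m} (inj₂ _)    = inj₂ (i , inj₁ (m , refl))
u-covers {x = w i} (inj₂ _)      = inj₂ (i , inj₂ refl)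

U0orW-covers-u : InU0orW t → Covers t (u m)
U0orW-covers-u (inj₁ (inj₁ refl))               = inj₂ tt
U0orW-covers-u (inj₂ (_ , refl))                = inj₂ tt
U0orW-covers-u {m = m} (inj₁ (inj₂ (j , refl))) with j ≟ᶠ m
... | yes refl = inj₁ refl
... | no j≢m   = inj₂ j≢m

u-covers-U0orW : InU0orW x → Covers (u j) x
u-covers-U0orW (inj₁ (inj₁ refl))               = inj₂ tt
u-covers-U0orW (inj₂ (_ , refl))                = inj₂ tt
u-covers-U0orW {j = j} (inj₁ (inj₂ (m , refl))) with j ≟ᶠ m
... | yes refl = inj₁ refl
... | no j≢m   = inj₂ j≢m

w-covers-U0 : InU0 x → Covers (w i) x
w-covers-U0 (inj₁ refl)       = inj₂ tt
w-covers-U0 (inj₂ (_ , refl)) = inj₂ tt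

W-clique : InW i t → InW i x → Covers t x
W-clique (inj₂ refl)       (inj₂ refl)       = inj₁ refl
W-clique (inj₂ refl)       (inj₁ (_ , refl)) = inj₂ refl
W-clique (inj₁ (_ , refl)) (inj₂ refl)       = inj₂ refl
W-clique (inj₁ (j , refl)) (inj₁ (m , refl)) with j ≟ᶠ m
... | yes refl = inj₁ refl
... | no j≢m   = inj₂ (refl , j≢m)

covered-by-U : Fin k → (x : Vertex k r) → ∃[ j ] Covers (u j) x
covered-by-U j₀ (u m)   = m , inj₁ refl
covered-by-U j₀ u0      = j₀ , inj₂ tt
covered-by-U j₀ (v _ m) = m , inj₂ refl
covered-by-U j₀ (w _)   = j₀ , inj₂ tt

U0orW-≢v : InU0orW t → ¬ t ≡ v i j
U0orW-≢v (inj₁ (inj₁ refl))       ()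
U0orW-≢v (inj₁ (inj₂ (_ , refl))) ()
U0orW-≢v (inj₂ (_ , refl))        ()

W-≢u : InW i t → ¬ t ≡ u j
W-≢u (inj₁ (_ , refl)) ()
W-≢u (inj₂ refl)       ()

W-≢u0 : InW i t → ¬ t ≡ u0
W-≢u0 (inj₁ (_ , refl)) ()
W-≢u0 (inj₂ refl)       ()

module _ {k r : ℕ} (X : VSet k r) where

  missing-u : ¬ (∀ j → u j ∈ X) → ∃[ m ] (u m ∉ X)
  missing-u U⊈X with ¬∀⟶∃¬ _ (λ j → u j ∈ X) (λ j → u j ∈? X) U⊈X
  ... | m , um∉X = m , ¬-not um∉X

  ─-⊆ : (X ─ y) ⊆ X
  ─-⊆ {y = y} x x∈X─y with x ≟ y
  ... | no _ = x∈X─y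

  ∉-─ : y ∉ (X ─ y)
  ∉-─ {y = y} with y ≟ y
  ... | yes _  = refl
  ... | no y≢y = ⊥-elim (y≢y refl)

  ∈-─ : x ∈ X → ¬ x ≡ y → x ∈ (X ─ y)
  ∈-─ {x = x} {y = y} x∈X x≢y with x ≟ y
  ... | yes x≡y = ⊥-elim (x≢y x≡y)
  ... | no _    = x∈X

  coverer : Dominates X x → ∃[ t ] (t ∈ X × Covers t x)
  coverer (inj₁ x∈X)             = _ , x∈X , inj₁ refl
  coverer (inj₂ (t , t∈X , adj)) = t , t∈X , inj₂ adj

  covered-─ : t ∈ X → ¬ t ≡ y → Covers t x → Dominates (X ─ y) x
  covered-─ t∈X t≢y (inj₁ refl) = inj₁ (∈-─ t∈X t≢y)
  covered-─ t∈X t≢y (inj₂ adj)  = inj₂ (_ , ∈-─ t∈X t≢y , adj)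

  redundant⇒dominating : Dominating X → Redundant X y → Dominating (X ─ y)
  redundant⇒dominating {y = y} D red x with coverer (D x)
  ... | t , t∈X , c with t ≟ y
  ...   | yes refl = red x c
  ...   | no t≢y   = covered-─ t∈X t≢y c

  minimal⇒irredundant : MinimalDominating X → y ∈ X → ¬ Redundant X y
  minimal⇒irredundant {y = y} (D , minimal) y∈X red =
    minimal (X ─ y) (─-⊆ {y = y}) (y , y∈X , ∉-─ {y = y}) (redundant⇒dominating D red)

  U0orW-meets : Dominating X → ∃[ y ] (y ∈ X × InU0orW y)
  U0orW-meets D with coverer (D u0)
  ... | t , t∈X , c = t , t∈X , covers-u0 c

  W-meets : Dominating X → u m ∉ X → (i : Fin r) → ∃[ y ] (y ∈ X × InW i y)
  W-meets {m = m} D um∉X i with coverer (D (v i m))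
  ... | t , t∈X , c with covers-v c
  ...   | inj₁ refl = ⊥-elim (not-¬ um∉X t∈X)
  ...   | inj₂ t∈W  = t , t∈X , t∈W

  V-meets : Dominating X → (i : Fin r) → ¬ (∀ j → u j ∈ X) → w i ∉ X → ∃[ y ] (y ∈ X × InV i y)
  V-meets D i U⊈X wi∉X with missing-u U⊈X
  ... | m , um∉X with W-meets D um∉X i
  ...   | y , y∈X , inj₁ y∈V  = y , y∈X , y∈V
  ...   | _ , wi∈X , inj₂ refl = ⊥-elim (not-¬ wi∉X wi∈X)

  v-redundant : Dominating X → InW i z → z ∈ X → ¬ z ≡ v i j → Redundant X (v i j)
  v-redundant D z∈W z∈X z≢v x c with v-covers c
  ... | inj₁ x∈W = covered-─ z∈X z≢v (W-clique z∈W x∈W)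
  ... | inj₂ refl with U0orW-meets D
  ...   | t , t∈X , t∈U0orW = covered-─ t∈X (U0orW-≢v t∈U0orW) (U0orW-covers-u t∈U0orW)

  v-irredundant : MinimalDominating X → v i j ∈ X → InW i t → t ∈ X → ¬ t ≡ v i j → ⊥
  v-irredundant MD v∈X t∈W t∈X t≢v = minimal⇒irredundant MD v∈X (v-redundant (proj₁ MD) t∈W t∈X t≢v)

  W-at-most-one : MinimalDominating X → ∀ (i : Fin r) y z → y ∈ X → InW i y → z ∈ X → InW i z → y ≡ z
  W-at-most-one MD i y z y∈X y∈W z∈X z∈W with y ≟ z | y∈W | z∈W
  ... | yes y≡z | _               | _               = y≡z
  ... | no y≢z  | inj₁ (_ , refl) | _               = ⊥-elim (v-irredundant MD y∈X z∈W z∈X (y≢z ∘ sym))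
  ... | no y≢z  | _               | inj₁ (_ , refl) = ⊥-elim (v-irredundant MD z∈X y∈W y∈X y≢z)
  ... | no y≢z  | inj₂ refl       | inj₂ refl       = ⊥-elim (y≢z refl)

  u0-alone : MinimalDominating X → u0 ∈ X → ∀ y → y ∈ X → InU0 y → y ≡ u0
  u0-alone MD u0∈X _ _    (inj₁ refl)       = refl
  u0-alone MD u0∈X _ uj∈X (inj₂ (_ , refl)) = ⊥-elim (minimal⇒irredundant MD u0∈X u0-redundant)
    where
    u0-redundant : Redundant X u0
    u0-redundant x c = covered-─ uj∈X (λ ()) (u-covers-U0orW (u0-covers c))

  U⊆X⇒redundant : Fin k → (∀ j → u j ∈ X) → ¬ InU y → Redundant X y
  U⊆X⇒redundant j₀ U⊆X y∉U x _ with covered-by-U j₀ x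
  ... | j , c = covered-─ (U⊆X j) (λ { refl → y∉U (j , refl) }) c

  U⊆X⇒X⊆U : Fin k → MinimalDominating X → (∀ j → u j ∈ X) → y ∈ X → InU y
  U⊆X⇒X⊆U {y = y} j₀ MD U⊆X y∈X with InU? y
  ... | yes y∈U = y∈U
  ... | no y∉U  = ⊥-elim (minimal⇒irredundant MD y∈X (U⊆X⇒redundant j₀ U⊆X y∉U))

  W-disjoint⇒U⊆X : Dominating X → (i : Fin r) → (∀ y → InW i y → y ∉ X) → ∀ j → u j ∈ X
  W-disjoint⇒U⊆X D i W∩X=∅ j with u j ∈? X
  ... | yes uj∈X = uj∈X
  ... | no uj∉X with W-meets D (¬-not uj∉X) i
  ...   | y , y∈X , y∈W = ⊥-elim (not-¬ (W∩X=∅ y y∈W) y∈X)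

  W-disjoint⇒X≡U : Fin k → MinimalDominating X → (i : Fin r) → (∀ y → InW i y → y ∉ X) → ∀ y → (y ∈ X ⇔ InU y)
  W-disjoint⇒X≡U j₀ MD i W∩X=∅ y = mk⇔ (U⊆X⇒X⊆U j₀ MD U⊆X) λ { (j , refl) → U⊆X j }
    where
    U⊆X : ∀ j → u j ∈ X
    U⊆X = W-disjoint⇒U⊆X (proj₁ MD) i W∩X=∅

  u0∈X⇒redundant : Fin k → Dominating X → w i ∈ X → Redundant X u0
  u0∈X⇒redundant j₀ D wi∈X x c with u0-covers c
  ... | inj₁ x∈U0       = covered-─ wi∈X (λ ()) (w-covers-U0 x∈U0)
  ... | inj₂ (i' , refl) with coverer (D (v i' j₀))
  ...   | t , t∈X , c' with covers-v c'
  ...     | inj₁ refl = covered-─ t∈X (λ ()) (inj₂ tt)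
  ...     | inj₂ t∈W  = covered-─ t∈X (W-≢u0 t∈W) (W-clique t∈W (inj₂ refl))

  u∈X⇒redundant : Dominating X → w i ∈ X → u m ∉ X → Redundant X (u j)
  u∈X⇒redundant D wi∈X um∉X x c with u-covers c
  ... | inj₁ x∈U0        = covered-─ wi∈X (λ ()) (w-covers-U0 x∈U0)
  ... | inj₂ (i' , x∈W)  with W-meets D um∉X i'
  ...   | t , t∈X , t∈W  = covered-─ t∈X (W-≢u t∈W) (W-clique t∈W x∈W)

  w∈X⇒U0-disjoint : Fin k → MinimalDominating X → (i : Fin r) → w i ∈ X → ∀ y → InU0 y → y ∉ X
  w∈X⇒U0-disjoint j₀ MD@(D , _) i wi∈X y y∈U0 with y ∈? X
  ... | no y∉X  = ¬-not y∉X
  ... | yes y∈X = ⊥-elim (y-redundant y∈U0 y∈X)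
    where
    y-redundant : InU0 y → y ∈ X → ⊥
    y-redundant (inj₁ refl) u0∈X = minimal⇒irredundant MD u0∈X (u0∈X⇒redundant j₀ D wi∈X)
    y-redundant (inj₂ (j , refl)) uj∈X with all? (λ m → u m ∈? X)
    ... | yes U⊆X = minimal⇒irredundant MD wi∈X (U⊆X⇒redundant j₀ U⊆X λ { (_ , ()) })
    ... | no U⊈X with missing-u U⊈X
    ...   | m , um∉X = minimal⇒irredundant MD uj∈X (u∈X⇒redundant D wi∈X um∉X)

lemma8 : (k r : ℕ) → 3 ≤ k → 1 ≤ r → r < k →
    (X : VSet k r) → Dominating X →
    (∃[ y ] (y ∈ X × InU0orW y)) ×
    (¬ (∀ j → u j ∈ X) → ∀ (i : Fin r) → ∃[ y ] (y ∈ X × InW i y)) ×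
    (∀ (i : Fin r) → ¬ (∀ j → u j ∈ X) → w i ∉ X → ∃[ y ] (y ∈ X × InV i y)) ×
    (MinimalDominating X →
      (∀ (i : Fin r) y z → y ∈ X → InW i y → z ∈ X → InW i z → y ≡ z) ×
      (u0 ∈ X → ∀ y → y ∈ X → InU0 y → y ≡ u0) ×
      (∀ (i : Fin r) → (∀ y → InW i y → y ∉ X) → ∀ y → (y ∈ X ⇔ InU y)) ×
      (∀ (i : Fin r) → w i ∈ X → ∀ y → InU0 y → y ∉ X))
lemma8 _ _ (s≤s _) _ _ X D =
  U0orW-meets X D ,
  (λ U⊈X → W-meets X D (proj₂ (missing-u X U⊈X))) ,
  V-meets X D ,
  λ MD → W-at-most-one X MD , u0-alone X MD , W-disjoint⇒X≡U X zero MD , w∈X⇒U0-disjoint X zero MD
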